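{- Let $h:\mathbb{N}\to\mathbb{N}$ be monotone and expansive, let $\alpha<\varepsilon_0$, and let $x\in\mathbb{N}$ with $x\geq N\alpha$. Then $h_\alpha(x)=\max_{\beta<\alpha,\,N\beta\leq x}\bigl(1+h_\beta(h(x))\bigr)$, where the maximum over the empty set is $0$.
   Context: A function $h:\mathbb{N}\to\mathbb{N}$ is monotone if $x\leq x'$ implies $h(x)\leq h(x')$, and expansive if $x\leq h(x)$ for all $x$. Ordinals below $\varepsilon_0$ are represented by terms in Cantor normal form $\alpha=\omega^{\alpha_1}\cdot c_1+\cdots+\omega^{\alpha_p}\cdot c_p$ with $\alpha>\alpha_1>\cdots>\alpha_p$ and $0<c_1,\dots,c_p<\omega$. The norm is $N\alpha=\max\{c_1,\dots,c_p,N\alpha_1,\dots,N\alpha_p\}$ (so $N0=0$). An ordinal $\alpha>0$ is a successor $\alpha'+1$ if its last exponent is $0$, otherwise a limit, written $\gamma+\omega^\beta$ with $\beta$ its last exponent. Fundamental sequences: $(\gamma+\omega^{\beta+1})(x)=\gamma+\omega^{\beta}\cdot(x+1)$ and $(\gamma+\omega^{\lambda})(x)=\gamma+\omega^{\lambda(x)}$ for limit $\lambda$. Predecessor of $\alpha>0$: $P_x(\alpha+1)=\alpha$, $P_x(\lambda)=P_x(\lambda(x))$ for limit $\lambda$. The Cichoń hierarchy is defined by $h_0(x)=0$ and, for $0<\alpha<\varepsilon_0$, $h_\alpha(x)=1+h_{P_x(\alpha)}(h(x))$. -}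

module Defs where

open import Data.Nat using (ℕ; zero; suc; _≤_; _<_; _⊔_; _∸_)
open import Data.Product using (∃-syntax; _×_)
open import Data.Sum using (_⊎_)
open import Data.Unit using (⊤)
open import Relation.Binary.PropositionalEquality using (_≡_)
open import Relation.Nullary using (¬_)

-- Ordinal terms: ω^ a · c + r  stands for  ω^a·c + r.
-- A term ω^α₁·c₁ + (ω^α₂·c₂ + (… + 𝟎)) is the Cantor normal form
-- ω^α₁·c₁ + ⋯ + ω^αₚ·cₚ ; validity is the predicate CNF below.
infixr 30 ω^_·_+_
infix 4 _<ₒ_

data Tm : Set where
  𝟎 : Tm
  ω^_·_+_ : Tm → ℕ → Tm → Tm

-- Ordinal order on terms (lexicographic; correct on CNF terms).
data _<ₒ_ : Tm → Tm → Set where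
  <-zero : ∀ {a c r} → 𝟎 <ₒ ω^ a · c + r
  <-exp  : ∀ {a c r b d s} → a <ₒ b → ω^ a · c + r <ₒ ω^ b · d + s
  <-coef : ∀ {a c r d s} → c < d → ω^ a · c + r <ₒ ω^ a · d + s
  <-rest : ∀ {a c r s} → r <ₒ s → ω^ a · c + r <ₒ ω^ a · c + s

LeadBelow : Tm → Tm → Set
LeadBelow 𝟎 a = ⊤
LeadBelow (ω^ b · _ + _) a = b <ₒ a

data CNF : Tm → Set where
  cnf-𝟎 : CNF 𝟎
  cnf-ω : ∀ {a c r} → CNF a → 0 < c → CNF r → LeadBelow r a → CNF (ω^ a · c + r)

N : Tm → ℕ
N 𝟎 = 0
N (ω^ a · c + r) = c ⊔ (N a ⊔ N r)

data Kind : Set where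
  zeroK succK limK : Kind

kind : Tm → Kind
kind 𝟎 = zeroK
kind (ω^ 𝟎 · c + 𝟎) = succK
kind (ω^ (ω^ _ · _ + _) · c + 𝟎) = limK
kind (ω^ a · c + (ω^ b · d + s)) = kind (ω^ b · d + s)

mk : Tm → ℕ → Tm → Tm
mk a zero r = r
mk a (suc c) r = ω^ a · suc c + r

-- predecessor of a successor: (α'+1) ↦ α'
pre : Tm → Tm
pre 𝟎 = 𝟎
pre (ω^ a · c + 𝟎) = mk a (c ∸ 1) 𝟎
pre (ω^ a · c + (ω^ b · d + s)) = ω^ a · c + pre (ω^ b · d + s)

-- Fundamental sequences:
--  (γ + ω^(β+1))(x) = γ + ω^β·(x+1),  (γ + ω^λ)(x) = γ + ω^(λ(x))
mutual
  fs : Tm → ℕ → Tm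
  fs 𝟎 x = 𝟎
  fs (ω^ a · c + 𝟎) x = mk a (c ∸ 1) (fsω a (kind a) x)
  fs (ω^ a · c + (ω^ b · d + s)) x = ω^ a · c + fs (ω^ b · d + s) x

  fsω : Tm → Kind → ℕ → Tm
  fsω a zeroK x = 𝟎
  fsω a succK x = ω^ pre a · suc x + 𝟎
  fsω a limK x = ω^ fs a x · 1 + 𝟎

-- Predecessor P_x as its graph:  P_x(α+1) = α,  P_x(λ) = P_x(λ(x))
data Pred (x : ℕ) : Tm → Tm → Set where
  p-suc : ∀ {α} → kind α ≡ succK → Pred x α (pre α)
  p-lim : ∀ {α β} → kind α ≡ limK → Pred x (fs α x) β → Pred x α β

-- Cichoń hierarchy as its graph:  Cichon h α x y  means  h_α(x) = y
--   h_0(x) = 0,  h_α(x) = 1 + h_{P_x(α)}(h(x))  for α > 0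
data Cichon (h : ℕ → ℕ) : Tm → ℕ → ℕ → Set where
  c-zero : ∀ {x} → Cichon h 𝟎 x 0
  c-pos  : ∀ {α x β y} → Pred x α β → Cichon h β (h x) y → Cichon h α x (suc y)

Monotone : (ℕ → ℕ) → Set
Monotone h = ∀ {x x′} → x ≤ x′ → h x ≤ h x′

Expansive : (ℕ → ℕ) → Set
Expansive h = ∀ x → x ≤ h x

IsMax0 : ℕ → (ℕ → Set) → Set
IsMax0 y S = (y ≡ 0 ⊎ S y) × (∀ v → S v → v ≤ y)

module Submission where

-- Write P_x for the predecessor and γ = P_x(α).  By definition
-- h_α(x) = 1 + h_γ(h(x)), so h_α(x) is itself a candidate as soon as
-- γ < α and Nγ ≤ x; maximality follows from two facts:
--   (1) P_x(α) is the largest β < α with Nβ ≤ x  (pred-max), which rests on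
--       pre α being the largest ordinal below a successor α (pre-max) and on
--       α(x) bounding every β < α with Nβ ≤ x for limit α (fs-max);
--   (2) for β ≤ γ with Nβ, Nγ ≤ y we have h_β(y) ≤ h_γ(y)  (cichon-mono),
--       by well-founded induction using (1) and expansiveness of h.
-- For (1) the norm bound Nγ ≤ x is carried through α ↦ α(x) by the
-- invariant Tame x, which tolerates the coefficient x+1 created by α(x).
-- Existence and uniqueness of h_α(x) come from well-foundedness of <ₒ on
-- Cantor normal forms.

open import Defs
open import Data.Nat using (ℕ; zero; suc; _≤_; _<_; _∸_; z≤n; s≤s)
open import Data.Nat.Properties
  using (≤-trans; ≤-refl; ≤-reflexive; <-trans; ⊔-lub; m⊔n≤o⇒m≤o; m⊔n≤o⇒n≤o; n≤1+n; m≤n⇒m<n∨m≡n)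
open import Data.Nat.Induction using (<-wellFounded)
open import Induction.WellFounded using (Acc; acc)
open import Data.Product using (∃-syntax; _×_; _,_; proj₁; proj₂; map₂)
open import Data.Sum using (_⊎_; inj₁; inj₂)
open import Data.Unit using (⊤; tt)
open import Data.Empty using (⊥; ⊥-elim)
open import Relation.Binary.PropositionalEquality using (_≡_; _≢_; refl; sym; trans; cong)

<ₒ-trans : ∀ {a b c} → a <ₒ b → b <ₒ c → a <ₒ c
<ₒ-trans <-zero (<-exp q) = <-zero
<ₒ-trans <-zero (<-coef q) = <-zero
<ₒ-trans <-zero (<-rest q) = <-zero
<ₒ-trans (<-exp p) (<-exp q) = <-exp (<ₒ-trans p q)
<ₒ-trans (<-exp p) (<-coef q) = <-exp p
<ₒ-trans (<-exp p) (<-rest q) = <-exp p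
<ₒ-trans (<-coef p) (<-exp q) = <-exp q
<ₒ-trans (<-coef p) (<-coef q) = <-coef (<-trans p q)
<ₒ-trans (<-coef p) (<-rest q) = <-coef p
<ₒ-trans (<-rest p) (<-exp q) = <-exp q
<ₒ-trans (<-rest p) (<-coef q) = <-coef q
<ₒ-trans (<-rest p) (<-rest q) = <-rest (<ₒ-trans p q)

infix 4 _≤ₒ_ _≺_

_≤ₒ_ : Tm → Tm → Set
β ≤ₒ γ = β ≡ γ ⊎ β <ₒ γ

lead-below-mono : ∀ {t t′ a} → t′ <ₒ t → LeadBelow t a → LeadBelow t′ a
lead-below-mono <-zero l = tt
lead-below-mono (<-exp p) l = <ₒ-trans p l
lead-below-mono (<-coef p) l = l
lead-below-mono (<-rest p) l = l

lead-below-< : ∀ t {a c r} → LeadBelow t a → t <ₒ ω^ a · c + r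
lead-below-< 𝟎 _ = <-zero
lead-below-< (ω^ _ · _ + _) l = <-exp l

lead-below-𝟎 : ∀ {r} → LeadBelow r 𝟎 → r ≡ 𝟎
lead-below-𝟎 {𝟎} _ = refl

cnf-exp : ∀ {b d s} → CNF (ω^ b · d + s) → CNF b
cnf-exp (cnf-ω cb _ _ _) = cb

cnf-rest : ∀ {b d s} → CNF (ω^ b · d + s) → CNF s
cnf-rest (cnf-ω _ _ cs _) = cs

cnf-lead : ∀ {b d s} → CNF (ω^ b · d + s) → LeadBelow s b
cnf-lead (cnf-ω _ _ _ l) = l

_≺_ : Tm → Tm → Set
β ≺ α = CNF β × β <ₒ α

≺-acc-𝟎 : Acc _≺_ 𝟎
≺-acc-𝟎 = acc λ { (_ , ()) }

mutual
  ≺-acc-lead : ∀ {a} → Acc _≺_ a → ∀ {t} → CNF t → LeadBelow t a → Acc _≺_ t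
  ≺-acc-lead _ {𝟎} _ _ = ≺-acc-𝟎
  ≺-acc-lead (acc below-a) {ω^ b · d + s} ct b<a =
    ≺-acc-ω (below-a (cnf-exp ct , b<a)) (<-wellFounded d)
      (≺-acc-lead (below-a (cnf-exp ct , b<a)) (cnf-rest ct) (cnf-lead ct)) (cnf-lead ct)

  -- lexicographic induction on exponent, coefficient and rest
  ≺-acc-ω : ∀ {a} → Acc _≺_ a → ∀ {c} → Acc _<_ c → ∀ {s} → Acc _≺_ s →
    LeadBelow s a → Acc _≺_ (ω^ a · c + s)
  ≺-acc-ω acc-a acc-c acc-s l = acc (below acc-a acc-c acc-s l)
    where
    below : ∀ {a} → Acc _≺_ a → ∀ {c} → Acc _<_ c → ∀ {s} → Acc _≺_ s → LeadBelow s a →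
      ∀ {y} → y ≺ ω^ a · c + s → Acc _≺_ y
    below _ _ _ _ (_ , <-zero) = ≺-acc-𝟎
    below acc-a _ _ _ (cy , <-exp p) = ≺-acc-lead acc-a cy p
    below acc-a (acc below-c) _ _ (cy , <-coef p) =
      ≺-acc-ω acc-a (below-c p) (≺-acc-lead acc-a (cnf-rest cy) (cnf-lead cy)) (cnf-lead cy)
    below acc-a acc-c (acc below-s) _ (cy , <-rest p) =
      ≺-acc-ω acc-a acc-c (below-s (cnf-rest cy , p)) (cnf-lead cy)

≺-acc : ∀ {t} → CNF t → Acc _≺_ t
≺-acc cnf-𝟎 = ≺-acc-𝟎
≺-acc (cnf-ω ca _ cr l) = ≺-acc-ω (≺-acc ca) (<-wellFounded _) (≺-acc cr) l

kind-tail : ∀ a {c b d s} → kind (ω^ a · c + (ω^ b · d + s)) ≡ kind (ω^ b · d + s)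
kind-tail 𝟎 = refl
kind-tail (ω^ _ · _ + _) = refl

tail-kind : ∀ {a c b d s k} → kind (ω^ a · c + (ω^ b · d + s)) ≡ k → kind (ω^ b · d + s) ≡ k
tail-kind {a} e = trans (sym (kind-tail a)) e

positive⇒kind≢zero : ∀ {α} → 𝟎 <ₒ α → kind α ≢ zeroK
positive⇒kind≢zero {ω^ 𝟎 · c + 𝟎} <-zero ()
positive⇒kind≢zero {ω^ (ω^ _ · _ + _) · c + 𝟎} <-zero ()
positive⇒kind≢zero {ω^ a · c + (ω^ b · d + s)} <-zero e =
  positive⇒kind≢zero {ω^ b · d + s} <-zero (tail-kind {a} e)

kind≢zero⇒positive : ∀ {α k} → kind α ≡ k → k ≢ zeroK → 𝟎 <ₒ α
kind≢zero⇒positive {𝟎} refl k≢zero = ⊥-elim (k≢zero refl)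
kind≢zero⇒positive {ω^ _ · _ + _} _ _ = <-zero

module _ {x} a c r (bound : N (ω^ a · c + r) ≤ x) where
  norm-coef : c ≤ x
  norm-coef = m⊔n≤o⇒m≤o c _ bound

  norm-exp : N a ≤ x
  norm-exp = m⊔n≤o⇒m≤o (N a) (N r) (m⊔n≤o⇒n≤o c _ bound)

  norm-rest : N r ≤ x
  norm-rest = m⊔n≤o⇒n≤o (N a) (N r) (m⊔n≤o⇒n≤o c _ bound)

norm-cons : ∀ {c x} a r → c ≤ x → N a ≤ x → N r ≤ x → N (ω^ a · c + r) ≤ x
norm-cons a r c≤x na nr = ⊔-lub c≤x (⊔-lub na nr)

lower-last : ∀ {a} t c → CNF a → CNF t × LeadBelow t a →
  CNF (mk a (c ∸ 1) t) × mk a (c ∸ 1) t <ₒ ω^ a · c + 𝟎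
lower-last t zero _ (ct , l) = ct , lead-below-< t l
lower-last t (suc zero) _ (ct , l) = ct , lead-below-< t l
lower-last t (suc (suc c)) ca (ct , l) = cnf-ω ca (s≤s z≤n) ct l , <-coef ≤-refl

pre-below : ∀ α → CNF α → 𝟎 <ₒ α → pre α ≺ α
pre-below (ω^ a · c + 𝟎) (cnf-ω ca _ _ _) _ = lower-last 𝟎 c ca (cnf-𝟎 , tt)
pre-below (ω^ a · c + r@(ω^ _ · _ + _)) (cnf-ω ca cp cr l) _ with pre-below r cr <-zero
... | cp′ , lt = cnf-ω ca cp cp′ (lead-below-mono lt l) , <-rest lt

pre-max : ∀ α → CNF α → kind α ≡ succK → ∀ {β} → CNF β → β <ₒ α → β ≤ₒ pre α
pre-max (ω^ a · zero + r) (cnf-ω _ () _ _) _ _ _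
pre-max (ω^ 𝟎 · suc zero + 𝟎) _ _ _ <-zero = inj₁ refl
pre-max (ω^ 𝟎 · suc (suc c) + 𝟎) _ _ _ <-zero = inj₂ <-zero
pre-max (ω^ 𝟎 · suc c + 𝟎) _ _ _ (<-exp ())
pre-max (ω^ 𝟎 · suc c + 𝟎) _ _ (cnf-ω _ () _ _) (<-coef (s≤s z≤n))
pre-max (ω^ 𝟎 · suc (suc c) + 𝟎) _ _ (cnf-ω _ _ _ l) (<-coef (s≤s (s≤s q)))
  with lead-below-𝟎 l | m≤n⇒m<n∨m≡n (s≤s q)
... | refl | inj₁ d<c = inj₂ (<-coef d<c)
... | refl | inj₂ refl = inj₁ refl
pre-max (ω^ 𝟎 · suc c + 𝟎) _ _ _ (<-rest ())
pre-max (ω^ (ω^ _ · _ + _) · c + 𝟎) _ () _ _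
pre-max (ω^ a · c + (ω^ b · d + s)) _ _ _ <-zero = inj₂ <-zero
pre-max (ω^ a · c + (ω^ b · d + s)) _ _ _ (<-exp p) = inj₂ (<-exp p)
pre-max (ω^ a · c + (ω^ b · d + s)) _ _ _ (<-coef p) = inj₂ (<-coef p)
pre-max (ω^ a · c + (ω^ b · d + s)) (cnf-ω _ _ cr _) e (cnf-ω _ _ cs _) (<-rest p)
  with pre-max (ω^ b · d + s) cr (tail-kind {a} e) cs p
... | inj₁ refl = inj₁ refl
... | inj₂ q = inj₂ (<-rest q)

Tame : ℕ → Tm → Set
Tame x 𝟎 = ⊤
Tame x (ω^ a · c + 𝟎) = (c ≤ suc x × N a ≤ x) ⊎ (c ≡ 1 × Tame x a)
Tame x (ω^ a · c + (ω^ b · d + s)) = c ≤ x × N a ≤ x × Tame x (ω^ b · d + s)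

tame-cons : ∀ {x a c} t → c ≤ x → N a ≤ x → Tame x t → Tame x (ω^ a · c + t)
tame-cons 𝟎 c≤x na _ = inj₁ (≤-trans c≤x (n≤1+n _) , na)
tame-cons (ω^ _ · _ + _) c≤x na w = c≤x , na , w

bounded⇒tame : ∀ {x} α → N α ≤ x → Tame x α
bounded⇒tame 𝟎 _ = tt
bounded⇒tame (ω^ a · c + r) bound =
  tame-cons r (norm-coef a c r bound) (norm-exp a c r bound) (bounded⇒tame r (norm-rest a c r bound))

last-exp-tame : ∀ {x} a c → Tame x (ω^ a · c + 𝟎) → Tame x a
last-exp-tame a c (inj₁ (_ , na)) = bounded⇒tame a na
last-exp-tame a c (inj₂ (_ , wa)) = wa

tame-pre-norm : ∀ {x} α → Tame x α → kind α ≡ succK → N (pre α) ≤ x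
tame-pre-norm (ω^ 𝟎 · zero + 𝟎) _ _ = z≤n
tame-pre-norm (ω^ 𝟎 · suc zero + 𝟎) _ _ = z≤n
tame-pre-norm (ω^ 𝟎 · suc (suc c) + 𝟎) (inj₁ (s≤s c+1≤x , _)) _ = norm-cons 𝟎 𝟎 c+1≤x z≤n z≤n
tame-pre-norm (ω^ 𝟎 · suc (suc c) + 𝟎) (inj₂ (() , _)) _
tame-pre-norm (ω^ (ω^ _ · _ + _) · c + 𝟎) _ ()
tame-pre-norm (ω^ a · c + r@(ω^ _ · _ + _)) (c≤x , na , w) e =
  norm-cons a (pre r) c≤x na (tame-pre-norm r w (tail-kind {a} e))

single-term : ∀ {e a} k → e ≺ a → CNF (ω^ e · suc k + 𝟎) × LeadBelow (ω^ e · suc k + 𝟎) a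
single-term k (ce , e<a) = cnf-ω ce (s≤s z≤n) cnf-𝟎 tt , e<a

mutual
  fsω-below : ∀ a → CNF a → ∀ x → CNF (fsω a (kind a) x) × LeadBelow (fsω a (kind a) x) a
  fsω-below a ca x with kind a in eq
  ... | zeroK = cnf-𝟎 , tt
  ... | succK = single-term x (pre-below a ca (kind≢zero⇒positive eq λ ()))
  ... | limK = single-term 0 (fs-below a ca (kind≢zero⇒positive eq λ ()) x)

  fs-below : ∀ α → CNF α → 𝟎 <ₒ α → ∀ x → fs α x ≺ α
  fs-below (ω^ a · c + 𝟎) (cnf-ω ca _ _ _) _ x = lower-last _ c ca (fsω-below a ca x)
  fs-below (ω^ a · c + r@(ω^ _ · _ + _)) (cnf-ω ca cp cr l) _ x with fs-below r cr <-zero x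
  ... | cf , lt = cnf-ω ca cp cf (lead-below-mono lt l) , <-rest lt

fsω-positive : ∀ {a} x → 𝟎 <ₒ a → 𝟎 <ₒ fsω a (kind a) x
fsω-positive {a} x pa with kind a in eq
... | zeroK = ⊥-elim (positive⇒kind≢zero pa eq)
... | succK = <-zero
... | limK = <-zero

fs-positive : ∀ α x → kind α ≡ limK → 𝟎 <ₒ fs α x
fs-positive (ω^ 𝟎 · c + 𝟎) x ()
fs-positive (ω^ (ω^ _ · _ + _) · zero + 𝟎) x _ = fsω-positive x <-zero
fs-positive (ω^ (ω^ _ · _ + _) · suc zero + 𝟎) x _ = fsω-positive x <-zero
fs-positive (ω^ (ω^ _ · _ + _) · suc (suc c) + 𝟎) x _ = <-zero
fs-positive (ω^ a · c + (ω^ b · d + s)) x _ = <-zero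

below-ω-coef : ∀ {b e d s x} → b ≤ₒ e → d ≤ x → ω^ b · d + s <ₒ ω^ e · suc x + 𝟎
below-ω-coef (inj₁ refl) d≤x = <-coef (s≤s d≤x)
below-ω-coef (inj₂ b<e) _ = <-exp b<e

below-single-lead : ∀ {A β} → CNF β → β <ₒ ω^ A · 1 + 𝟎 → LeadBelow β A
below-single-lead _ <-zero = tt
below-single-lead _ (<-exp p) = p
below-single-lead (cnf-ω _ () _ _) (<-coef (s≤s z≤n))
below-single-lead _ (<-rest ())

mutual
  fsω-max : ∀ a → CNF a → 𝟎 <ₒ a → ∀ {t x} → CNF t → LeadBelow t a → N t ≤ x →
    t <ₒ fsω a (kind a) x
  fsω-max a _ pa {𝟎} _ _ _ = fsω-positive _ pa
  fsω-max a ca pa {ω^ b · d + s} ct b<a nt with kind a in eq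
  ... | zeroK = ⊥-elim (positive⇒kind≢zero pa eq)
  ... | succK = below-ω-coef (pre-max a ca eq (cnf-exp ct) b<a) (norm-coef b d s nt)
  ... | limK = <-exp (fs-max a ca eq (cnf-exp ct) b<a (norm-exp b d s nt))

  fs-max : ∀ α → CNF α → kind α ≡ limK → ∀ {x β} → CNF β → β <ₒ α → N β ≤ x → β <ₒ fs α x
  fs-max (ω^ 𝟎 · c + 𝟎) _ () _ _ _
  fs-max (ω^ A · zero + 𝟎) (cnf-ω _ () _ _) _ _ _ _
  fs-max (ω^ A@(ω^ _ · _ + _) · suc zero + 𝟎) (cnf-ω cA _ _ _) _ cβ β<α nβ =
    fsω-max A cA <-zero cβ (below-single-lead cβ β<α) nβ
  fs-max (ω^ A@(ω^ _ · _ + _) · suc (suc m) + 𝟎) _ _ _ <-zero _ = <-zero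
  fs-max (ω^ A@(ω^ _ · _ + _) · suc (suc m) + 𝟎) _ _ _ (<-exp p) _ = <-exp p
  fs-max (ω^ A@(ω^ _ · _ + _) · suc (suc m) + 𝟎) (cnf-ω cA _ _ _) _ {x} {ω^ _ · d + s} cβ
    (<-coef (s≤s d≤m+1)) nβ with m≤n⇒m<n∨m≡n d≤m+1
  ... | inj₁ d<m+1 = <-coef d<m+1
  ... | inj₂ refl = <-rest (fsω-max A cA <-zero (cnf-rest cβ) (cnf-lead cβ) (norm-rest A d s nβ))
  fs-max (ω^ A@(ω^ _ · _ + _) · suc c + 𝟎) _ _ _ (<-rest ()) _
  fs-max (ω^ a · c + (ω^ b · d + s)) _ _ _ <-zero _ = <-zero
  fs-max (ω^ a · c + (ω^ b · d + s)) _ _ _ (<-exp p) _ = <-exp p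
  fs-max (ω^ a · c + (ω^ b · d + s)) _ _ _ (<-coef p) _ = <-coef p
  fs-max (ω^ a · c + r@(ω^ _ · _ + _)) (cnf-ω _ _ cr _) e {x} {ω^ _ · _ + s′} cβ (<-rest p) nβ =
    <-rest (fs-max r cr (tail-kind {a} e) (cnf-rest cβ) p (norm-rest a c s′ nβ))

mutual
  tame-fs : ∀ {x} α → Tame x α → Tame x (fs α x)
  tame-fs 𝟎 _ = tt
  tame-fs (ω^ a · zero + 𝟎) w = tame-fsω a (last-exp-tame a zero w)
  tame-fs (ω^ a · suc zero + 𝟎) w = tame-fsω a (last-exp-tame a 1 w)
  tame-fs (ω^ a · suc (suc m) + 𝟎) (inj₁ (s≤s m+1≤x , na)) =
    tame-cons _ m+1≤x na (tame-fsω a (bounded⇒tame a na))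
  tame-fs (ω^ a · suc (suc m) + 𝟎) (inj₂ (() , _))
  tame-fs {x} (ω^ a · c + r@(ω^ _ · _ + _)) (c≤x , na , w) = tame-cons (fs r x) c≤x na (tame-fs r w)

  tame-fsω : ∀ {x} a → Tame x a → Tame x (fsω a (kind a) x)
  tame-fsω a w with kind a in eq
  ... | zeroK = tt
  ... | succK = inj₁ (≤-refl , tame-pre-norm a w eq)
  ... | limK = inj₂ (refl , tame-fs a w)

pred-below : ∀ {x α β} → Pred x α β → CNF α → β ≺ α
pred-below {α = α} (p-suc e) cα = pre-below α cα (kind≢zero⇒positive e λ ())
pred-below {x} {α} (p-lim e p) cα with fs-below α cα (kind≢zero⇒positive e λ ()) x
... | cf , f<α with pred-below p cf
...   | cβ , β<f = cβ , <ₒ-trans β<f f<α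

pred-bounded : ∀ {x α β} → Pred x α β → N α ≤ x → N β ≤ x
pred-bounded {α = α} p nα = tame-norm p (bounded⇒tame α nα)
  where
  tame-norm : ∀ {x α β} → Pred x α β → Tame x α → N β ≤ x
  tame-norm {α = α} (p-suc e) w = tame-pre-norm α w e
  tame-norm {α = α} (p-lim _ p) w = tame-norm p (tame-fs α w)

pred-max : ∀ {x α γ β} → Pred x α γ → CNF α → CNF β → β <ₒ α → N β ≤ x → β ≤ₒ γ
pred-max {α = α} (p-suc e) cα cβ β<α _ = pre-max α cα e cβ β<α
pred-max {x} {α} (p-lim e p) cα cβ β<α nβ =
  pred-max p (proj₁ (fs-below α cα (kind≢zero⇒positive e λ ()) x)) cβ (fs-max α cα e cβ β<α nβ) nβ

pred-unique : ∀ {x α β β′} → Pred x α β → Pred x α β′ → β ≡ β′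
pred-unique (p-suc _) (p-suc _) = refl
pred-unique (p-suc e) (p-lim e′ _) with trans (sym e) e′
... | ()
pred-unique (p-lim e _) (p-suc e′) with trans (sym e′) e
... | ()
pred-unique (p-lim _ p) (p-lim _ p′) = pred-unique p p′

pred-𝟎 : ∀ {x β} → Pred x 𝟎 β → ⊥
pred-𝟎 (p-suc ())
pred-𝟎 (p-lim () _)

pred-exists : ∀ {α} → Acc _≺_ α → CNF α → 𝟎 <ₒ α → ∀ x → ∃[ β ] Pred x α β
pred-exists {α} (acc below-α) cα pα x with kind α in eq
... | zeroK = ⊥-elim (positive⇒kind≢zero pα eq)
... | succK = pre α , p-suc eq
... | limK = map₂ (p-lim eq)
  (pred-exists (below-α fα≺α) (proj₁ fα≺α) (fs-positive α x eq) x)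
  where
  fα≺α = fs-below α cα (kind≢zero⇒positive eq λ ()) x

module _ (h : ℕ → ℕ) where

  cichon-unique : ∀ {α x y y′} → Cichon h α x y → Cichon h α x y′ → y ≡ y′
  cichon-unique c-zero c-zero = refl
  cichon-unique c-zero (c-pos p _) = ⊥-elim (pred-𝟎 p)
  cichon-unique (c-pos p _) c-zero = ⊥-elim (pred-𝟎 p)
  cichon-unique (c-pos p hβ) (c-pos p′ hβ′) with pred-unique p p′
  ... | refl = cong suc (cichon-unique hβ hβ′)

  cichon-exists : ∀ {α} → Acc _≺_ α → CNF α → ∀ x → ∃[ y ] Cichon h α x y
  cichon-exists {𝟎} _ _ x = 0 , c-zero
  cichon-exists {ω^ _ · _ + _} acc-α@(acc below-α) cα x with pred-exists acc-α cα <-zero x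
  ... | β , p with pred-below p cα
  ...   | β≺α with cichon-exists (below-α β≺α) (proj₁ β≺α) (h x)
  ...     | y , hβ = suc y , c-pos p hβ

  -- h_β(y) ≤ h_γ(y) whenever β ≤ γ and both have norm ≤ y: the predecessors
  -- at y stay in this relation by pred-max, and their norms stay ≤ h(y).
  cichon-mono : Expansive h → ∀ {γ} → Acc _≺_ γ → CNF γ → ∀ {y β u v} → CNF β → β ≤ₒ γ →
    N β ≤ y → N γ ≤ y → Cichon h β y u → Cichon h γ y v → u ≤ v
  cichon-mono _ _ _ _ (inj₁ refl) _ _ hβ hγ = ≤-reflexive (cichon-unique hβ hγ)
  cichon-mono _ _ _ _ (inj₂ _) _ _ c-zero _ = z≤n
  cichon-mono _ _ _ _ (inj₂ ()) _ _ (c-pos _ _) c-zero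
  cichon-mono ex (acc below-γ) cγ {y} cβ (inj₂ β<γ) nβ nγ (c-pos pβ hβ′) (c-pos pγ hγ′)
    with pred-below pβ cβ | pred-below pγ cγ
  ... | cβ′ , β′<β | γ′≺γ@(cγ′ , _) =
    s≤s (cichon-mono ex (below-γ γ′≺γ) cγ′ cβ′
      (pred-max pγ cγ cβ′ (<ₒ-trans β′<β β<γ) nβ′)
      (≤-trans nβ′ (ex y)) (≤-trans (pred-bounded pγ nγ) (ex y)) hβ′ hγ′)
    where
    nβ′ = pred-bounded pβ nβ

proposition3p2 : (h : ℕ → ℕ) → Monotone h → Expansive h →
    (α : Tm) → CNF α → (x : ℕ) → N α ≤ x →
    ∃[ y ] (Cichon h α x y ×
      IsMax0 y (λ v → ∃[ β ] (CNF β × β <ₒ α × N β ≤ x ×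
        ∃[ w ] (Cichon h β (h x) w × v ≡ suc w))))
proposition3p2 h _ ex 𝟎 _ x _ = 0 , c-zero , inj₁ refl , λ { _ (_ , _ , () , _) }
proposition3p2 h _ ex α@(ω^ _ · _ + _) cα x nα with cichon-exists h (≺-acc cα) cα x
... | _ , hα@(c-pos {β = γ} pγ hγ) =
  _ , hα , inj₂ (γ , cγ , γ<α , nγ , _ , hγ , refl) ,
  λ { _ (β , cβ , β<α , nβ , _ , hβ , refl) →
        s≤s (cichon-mono h ex (≺-acc cγ) cγ cβ (pred-max pγ cα cβ β<α nβ)
          (≤-trans nβ (ex x)) (≤-trans nγ (ex x)) hβ hγ) }
  where
  cγ = proj₁ (pred-below pγ cα)
  γ<α = proj₂ (pred-below pγ cα)
  nγ = pred-bounded pγ nα
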